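{- For every $n \geq 1$, the number $L_n$ of labelled loop-threshold graphs on vertex set $[n]$ satisfies $$L_n = \sum_{k=0}^{n-1} E(n,k)\,2^{k+1}.$$
   Context: Graphs here are finite, may have loops, but have no multiple edges. A graph is loop-threshold if it belongs to the smallest family of such graphs that contains $K_1$ (a single unlooped vertex) and $K_1^{\rm loop}$ (a single vertex with a loop), and is closed under adding an isolated (unlooped) vertex and adding a looped dominating vertex (a new vertex with a loop, adjacent to all existing vertices). A labelled loop-threshold graph on $[n]$ is such a graph with vertex set $[n]$; distinct sets of edges and loops give distinct graphs. $E(n,k)$ is the Eulerian number: the number of permutations $\pi$ of $[n]$ with exactly $k$ ascents (indices $i\in[n-1]$ with $\pi_i<\pi_{i+1}$). -}

module Defs where

open import Data.Nat using (ℕ; zero; suc; _+_; _*_; _^_; _≤_; _<ᵇ_)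
open import Data.Bool using (Bool; true; false; if_then_else_; _∧_; not)
open import Data.Fin using (Fin; punchIn; toℕ)
open import Data.Fin.Properties using () renaming (_≟_ to _≟F_)
open import Data.Vec using (Vec; []; _∷_; lookup; tabulate; toList)
open import Data.List as L using (List; []; _∷_; length; filter; concatMap; allFin)
open import Data.List.Membership.Propositional using (_∈_)
open import Data.List.Relation.Unary.Unique.Propositional using (Unique)
open import Data.Product using (Σ; _×_; _,_)
open import Data.Sum using (_⊎_)
open import Function.Bundles using (_⇔_)
open import Relation.Binary.PropositionalEquality using (_≡_)
open import Relation.Nullary.Decidable using (⌊_⌋)

sumTo : ℕ → (ℕ → ℕ) → ℕ
sumTo zero    f = 0
sumTo (suc n) f = sumTo n f + f n

-- "the number of elements of A satisfying P is N":
-- some duplicate-free list enumerates exactly the elements satisfying P.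

HasCount : {A : Set} → (A → Set) → ℕ → Set
HasCount {A} P N =
  Σ (List A) λ xs → Unique xs × ((∀ x → (x ∈ xs) ⇔ P x) × (length xs ≡ N))

-- Graphs on vertex set Fin n (= [n]), loops allowed, no multi-edges:
-- a symmetric Boolean adjacency matrix; the diagonal records loops.

Matrix : ℕ → Set
Matrix n = Vec (Vec Bool n) n

adj : ∀ {n} → Matrix n → Fin n → Fin n → Bool
adj A i j = lookup (lookup A i) j

Symmetric : ∀ {n} → Matrix n → Set
Symmetric {n} A = ∀ (i j : Fin n) → adj A i j ≡ adj A j i

delete : ∀ {n} → Fin (suc n) → Matrix (suc n) → Matrix n
delete v A = tabulate λ i → tabulate λ j → adj A (punchIn v i) (punchIn v j)

IsolatedUnlooped : ∀ {n} → Matrix n → Fin n → Set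
IsolatedUnlooped {n} A v = ∀ (j : Fin n) → adj A v j ≡ false

LoopedDominating : ∀ {n} → Matrix n → Fin n → Set
LoopedDominating {n} A v = ∀ (j : Fin n) → adj A v j ≡ true

-- Loop-threshold graphs (labelled version of the inductive definition):
-- every graph on one vertex (K1 or K1 with loop) is loop-threshold, and a
-- graph is loop-threshold if it has a vertex v which is isolated and
-- unlooped, or looped and dominating, such that deleting v leaves a
-- loop-threshold graph.  (This is the closure under relabelling of the
-- family generated by the stated operations.)
data LoopThreshold : ∀ {n} → Matrix n → Set where
  base : (b : Bool) → LoopThreshold ((b ∷ []) ∷ [])
  addIsolated : ∀ {n} (A : Matrix (suc n)) (v : Fin (suc n)) →
    IsolatedUnlooped A v → LoopThreshold (delete v A) → LoopThreshold A
  addDominating : ∀ {n} (A : Matrix (suc n)) (v : Fin (suc n)) →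
    LoopedDominating A v → LoopThreshold (delete v A) → LoopThreshold A

LabelledLoopThreshold : (n : ℕ) → Matrix n → Set
LabelledLoopThreshold n A = Symmetric A × LoopThreshold A

-- Eulerian numbers E(n,k): number of permutations of [n] (written in
-- one-line notation as vectors over Fin n) with exactly k ascents.

allVecs : (n m : ℕ) → List (Vec (Fin n) m)
allVecs n zero    = [] ∷ []
allVecs n (suc m) = concatMap (λ x → L.map (x ∷_) (allVecs n m)) (allFin n)

notIn : ∀ {n} → Fin n → List (Fin n) → Bool
notIn x []       = true
notIn x (y ∷ ys) = not ⌊ x ≟F y ⌋ ∧ notIn x ys

distinct : ∀ {n} → List (Fin n) → Bool
distinct []       = true
distinct (x ∷ xs) = notIn x xs ∧ distinct xs

ascents : ∀ {n} → List (Fin n) → ℕ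
ascents []           = 0
ascents (x ∷ [])     = 0
ascents (x ∷ y ∷ xs) = (if toℕ x <ᵇ toℕ y then 1 else 0) + ascents (y ∷ xs)

permutations : (n : ℕ) → List (Vec (Fin n) n)
permutations n = filter (λ p → distinct (toList p) Data.Bool.≟ true) (allVecs n n)

Eulerian : ℕ → ℕ → ℕ
Eulerian n k = length (filter (λ p → ascents (toList p) Data.Nat.≟ k) (permutations n))

-- Every symmetric loop-threshold graph has a vertex whose row is constant (isolated and
-- unlooped, or looped and dominating), and deleting any vertex keeps it loop-threshold.
-- Repeatedly deleting the least such vertex encodes the graph bijectively as a permutation
-- of its vertices (the deletion order) together with the types of the deleted vertices,
-- subject to one rule: two consecutive deletions of the same type happen in increasing
-- order, since otherwise the later vertex would have been deleted first.  For a permutation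
-- with k ascents there are 2^(k+1) such type sequences: the first type is free, and each
-- following one is free after an ascent and forced to change after a descent.

module Submission where

open import Defs
open import Data.Nat using (ℕ; zero; suc; _+_; _*_; _^_; _≤_; _<_; _<ᵇ_; z≤n; s≤s)
import Data.Nat.Properties as ℕ
open import Data.Nat.ListAction using (sum)
open import Data.Nat.ListAction.Properties using (sum-↭)
open import Data.Bool using (Bool; true; false; not; T; if_then_else_)
import Data.Bool.Properties as Bool
open import Data.Fin as Fin using (Fin; zero; suc; punchIn; punchOut; toℕ)
open import Data.Fin.Properties
  using ( _≟_; all?; toℕ-injective; punchIn-injective; punchInᵢ≢i; punchIn-punchOut; punchOut-punchIn
        ; punchOut-cong; punchIn-mono-≤; punchIn-cancel-≤)
open import Data.Vec as Vec using (Vec; []; _∷_; lookup; tabulate; head; toList)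
open import Data.Vec.Properties
  using (lookup∘tabulate; tabulate∘lookup; tabulate-cong; toList-map; length-toList; ∷-injective; ∷-injectiveʳ)
open import Data.List using (List; []; _∷_; map; concatMap; length; filter; allFin)
open import Data.List.Properties using (length-++; length-map; filter-accept; filter-reject; map-∘; map-cong)
open import Data.List.Extrema.Nat using (argmax; f[xs]≤f[argmax]; max; xs≤max)
open import Data.List.Membership.Propositional using (_∈_; lose; find)
open import Data.List.Membership.Propositional.Properties
  using (∈-map⁺; ∈-map⁻; ∈-concatMap⁺; ∈-concatMap⁻; ∈-allFin; ∈-filter⁺; ∈-filter⁻)
open import Data.List.Membership.Propositional.Properties.WithK using (unique∧set⇒bag)
open import Data.List.Relation.Binary.BagAndSetEquality using (∼bag⇒↭)
open import Data.List.Relation.Binary.Permutation.Propositional using (_↭_)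
import Data.List.Relation.Binary.Permutation.Propositional.Properties as ↭
open import Data.List.Relation.Unary.All as All using (All; []; _∷_)
import Data.List.Relation.Unary.All.Properties as All
open import Data.List.Relation.Unary.AllPairs as AllPairs using ([]; _∷_)
import Data.List.Relation.Unary.AllPairs.Properties as AllPairs
open import Data.List.Relation.Unary.Any using (here; there)
open import Data.List.Relation.Unary.Unique.Propositional using (Unique)
open import Data.List.Relation.Unary.Unique.Propositional.Properties using (map⁺; map⁻; concat⁺; allFin⁺; filter⁺)
open import Data.Unit using (⊤; tt)
open import Data.Product using (Σ; ∃; ∃₂; _×_; _,_; proj₁; proj₂; uncurry)
open import Data.Empty using (⊥; ⊥-elim)
open import Function using (_∘_)
open import Function.Bundles using (_⇔_; mk⇔; Equivalence)
open import Relation.Nullary using (Dec; yes; no)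
open import Relation.Nullary.Decidable using (⌊_⌋)
open import Relation.Nullary.Reflects using (det; fromEquivalence)
open import Relation.Unary using (Decidable)
open import Relation.Binary.PropositionalEquality
open import Algebra.Properties.CommutativeSemigroup ℕ.+-commutativeSemigroup using (interchange)

private variable
  k m n : ℕ

module _ {A B C : Set} (f : A → B → C) (ys : A → List B) where

  ∈-concatMap-map⁺ : ∀ {xs x y} → x ∈ xs → y ∈ ys x →
    f x y ∈ concatMap (λ x → map (f x) (ys x)) xs
  ∈-concatMap-map⁺ x∈ y∈ = ∈-concatMap⁺ _ (lose x∈ (∈-map⁺ (f _) y∈))

  ∈-concatMap-map⁻ : ∀ {xs z} → z ∈ concatMap (λ x → map (f x) (ys x)) xs →
    ∃₂ λ x y → x ∈ xs × y ∈ ys x × z ≡ f x y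
  ∈-concatMap-map⁻ z∈ with find (∈-concatMap⁻ _ z∈)
  ... | x , x∈ , z∈fx with ∈-map⁻ (f x) z∈fx
  ...   | y , y∈ , z≡ = x , y , x∈ , y∈ , z≡

  Unique-concatMap-map : (g : C → A) → (∀ x y → g (f x y) ≡ x) →
    (∀ {x y y′} → f x y ≡ f x y′ → y ≡ y′) →
    ∀ {xs} → Unique xs → (∀ x → Unique (ys x)) →
    Unique (concatMap (λ x → map (f x) (ys x)) xs)
  Unique-concatMap-map g g∘f f-injective xs! ys! =
    concat⁺ (All.map⁺ (All.universal (λ x → map⁺ f-injective (ys! x)) _))
            (AllPairs.map⁺ (AllPairs.map disjoint xs!))
    where
    disjoint : ∀ {x x′} → x ≢ x′ → ∀ {z} → z ∈ map (f x) (ys x) × z ∈ map (f x′) (ys x′) → ⊥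
    disjoint x≢x′ (z∈ , z∈′) with ∈-map⁻ _ z∈ | ∈-map⁻ _ z∈′
    ... | y , _ , refl | y′ , _ , e = x≢x′ (trans (sym (g∘f _ y)) (trans (cong g e) (g∘f _ y′)))

  length-concatMap-map : ∀ xs →
    length (concatMap (λ x → map (f x) (ys x)) xs) ≡ sum (map (λ x → length (ys x)) xs)
  length-concatMap-map [] = refl
  length-concatMap-map (x ∷ xs) =
    trans (length-++ (map (f x) (ys x))) (cong₂ _+_ (length-map (f x) (ys x)) (length-concatMap-map xs))

module _ {A : Set} where

  ↭-from-members : ∀ {xs ys : List A} → Unique xs → Unique ys →
    (∀ {z} → z ∈ xs ⇔ z ∈ ys) → xs ↭ ys
  ↭-from-members xs! ys! same = ∼bag⇒↭ (unique∧set⇒bag xs! ys! same)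

  sum-map-↭ : (h : A → ℕ) {xs ys : List A} → xs ↭ ys → sum (map h xs) ≡ sum (map h ys)
  sum-map-↭ h xs↭ys = sum-↭ (↭.map⁺ h xs↭ys)

  Unique-map-on : {B : Set} (f : A → B) {xs : List A} →
    (∀ {x y} → x ∈ xs → y ∈ xs → f x ≡ f y → x ≡ y) → Unique xs → Unique (map f xs)
  Unique-map-on f inj [] = []
  Unique-map-on f inj (x∉ ∷ xs!) =
    All.map⁺ (All.tabulate λ y∈ fx≡fy → All.lookup x∉ y∈ (inj (here refl) (there y∈) fx≡fy))
    ∷ Unique-map-on f (λ x∈ y∈ → inj (there x∈) (there y∈)) xs!

  sum-map-const : (h : A → ℕ) {c : ℕ} → (∀ x → h x ≡ c) → ∀ xs → sum (map h xs) ≡ c * length xs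
  sum-map-const h {c} h≗c []       = sym (ℕ.*-zeroʳ c)
  sum-map-const h {c} h≗c (x ∷ xs) = trans (cong₂ _+_ (h≗c x) (sum-map-const h h≗c xs)) (sym (ℕ.*-suc c _))

  HasCount-map : {B : Set} {P : B → Set} (f : A → B) {xs : List A} → Unique xs →
    (∀ {x y} → x ∈ xs → y ∈ xs → f x ≡ f y → x ≡ y) →
    (∀ b → P b ⇔ (Σ A λ x → x ∈ xs × f x ≡ b)) → HasCount P (length xs)
  HasCount-map {P = P} f {xs} xs! inj image =
    map f xs , Unique-map-on f inj xs! , (λ b → mk⇔ (to b) (from b)) , length-map f xs
    where
    to : ∀ b → b ∈ map f xs → P b
    to b b∈ with ∈-map⁻ f b∈
    ... | x , x∈ , refl = Equivalence.from (image b) (x , x∈ , refl)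
    from : ∀ b → P b → b ∈ map f xs
    from b pb with Equivalence.to (image b) pb
    ... | x , x∈ , refl = ∈-map⁺ f x∈

sumTo-cong : ∀ n {f g : ℕ → ℕ} → (∀ {k} → k < n → f k ≡ g k) → sumTo n f ≡ sumTo n g
sumTo-cong zero    f≗g = refl
sumTo-cong (suc n) f≗g = cong₂ _+_ (sumTo-cong n (f≗g ∘ ℕ.m<n⇒m<1+n)) (f≗g (ℕ.n<1+n n))

sumTo-+ : ∀ n (f g : ℕ → ℕ) → sumTo n (λ k → f k + g k) ≡ sumTo n f + sumTo n g
sumTo-+ zero    f g = refl
sumTo-+ (suc n) f g = trans (cong (_+ (f n + g n)) (sumTo-+ n f g))
  (interchange (sumTo n f) (sumTo n g) (f n) (g n))

sumTo-zero : ∀ n {f : ℕ → ℕ} → (∀ {k} → k < n → f k ≡ 0) → sumTo n f ≡ 0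
sumTo-zero zero    f≗0 = refl
sumTo-zero (suc n) f≗0 = cong₂ _+_ (sumTo-zero n (f≗0 ∘ ℕ.m<n⇒m<1+n)) (f≗0 (ℕ.n<1+n n))

sumTo-indicator : ∀ n {a} (c : ℕ → ℕ) → a < n →
  sumTo n (λ k → if ⌊ a ℕ.≟ k ⌋ then c k else 0) ≡ c a
sumTo-indicator (suc n) {a} c a<1+n with a ℕ.≟ n
... | yes refl = cong (_+ c a) (sumTo-zero n if-below)
  where
  if-below : ∀ {k} → k < a → (if ⌊ a ℕ.≟ k ⌋ then c k else 0) ≡ 0
  if-below {k} k<a with a ℕ.≟ k
  ... | yes refl = ⊥-elim (ℕ.<-irrefl refl k<a)
  ... | no _     = refl
... | no a≢n = trans (ℕ.+-identityʳ _) (sumTo-indicator n c (ℕ.≤∧≢⇒< (ℕ.≤-pred a<1+n) a≢n))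

sumTo-count : ∀ {A : Set} n (f : A → ℕ) (g : ℕ → ℕ) {xs : List A} → All (λ x → f x < n) xs →
  sumTo n (λ k → length (filter (λ x → f x ℕ.≟ k) xs) * g k) ≡ sum (map (λ x → g (f x)) xs)
sumTo-count n f g {[]}     []             = sumTo-zero n (λ _ → refl)
sumTo-count n f g {x ∷ xs} (fx<n ∷ xs<n) = begin
  sumTo n (λ k → length (filter (λ x → f x ℕ.≟ k) (x ∷ xs)) * g k)
    ≡⟨ sumTo-cong n (λ {k} _ → count-cons k) ⟩
  sumTo n (λ k → (if ⌊ f x ℕ.≟ k ⌋ then g k else 0) + length (filter (λ x → f x ℕ.≟ k) xs) * g k)
    ≡⟨ sumTo-+ n _ _ ⟩
  sumTo n (λ k → if ⌊ f x ℕ.≟ k ⌋ then g k else 0)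
    + sumTo n (λ k → length (filter (λ x → f x ℕ.≟ k) xs) * g k)
    ≡⟨ cong₂ _+_ (sumTo-indicator n g fx<n) (sumTo-count n f g xs<n) ⟩
  g (f x) + sum (map (λ x → g (f x)) xs) ∎
  where
  open ≡-Reasoning
  count-cons : ∀ k → length (filter (λ x → f x ℕ.≟ k) (x ∷ xs)) * g k
              ≡ (if ⌊ f x ℕ.≟ k ⌋ then g k else 0) + length (filter (λ x → f x ℕ.≟ k) xs) * g k
  count-cons k with f x ℕ.≟ k
  ... | yes fx≡k = cong (λ ys → length ys * g k) (filter-accept (λ x → f x ℕ.≟ k) fx≡k)
  ... | no  fx≢k = cong (λ ys → length ys * g k) (filter-reject (λ x → f x ℕ.≟ k) fx≢k)

-- Inserting and deleting a vertex

adj-tabulate : (f : Fin n → Fin n → Bool) (i j : Fin n) →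
  adj (tabulate λ i → tabulate (f i)) i j ≡ f i j
adj-tabulate f i j = trans (cong (λ row → lookup row j) (lookup∘tabulate _ i)) (lookup∘tabulate (f i) j)

Matrix-ext : {A B : Matrix n} → (∀ i j → adj A i j ≡ adj B i j) → A ≡ B
Matrix-ext {A = A} {B} A≗B = trans (sym (tabulate∘lookup A))
  (trans (tabulate-cong λ i → row-ext i) (tabulate∘lookup B))
  where
  row-ext : ∀ i → lookup A i ≡ lookup B i
  row-ext i = trans (sym (tabulate∘lookup _)) (trans (tabulate-cong (A≗B i)) (tabulate∘lookup _))

adj-delete : ∀ v (A : Matrix (suc n)) i j → adj (delete v A) i j ≡ adj A (punchIn v i) (punchIn v j)
adj-delete v A = adj-tabulate λ i j → adj A (punchIn v i) (punchIn v j)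

delete-symmetric : ∀ v {A : Matrix (suc n)} → Symmetric A → Symmetric (delete v A)
delete-symmetric v {A} A-sym i j =
  trans (adj-delete v A i j) (trans (A-sym _ _) (sym (adj-delete v A j i)))

data Split (v : Fin (suc n)) : Fin (suc n) → Set where
  pivot : Split v v
  other : ∀ i → Split v (punchIn v i)

split : (v i : Fin (suc n)) → Split v i
split v i with v ≟ i
... | yes refl = pivot
... | no v≢i   = subst (Split v) (punchIn-punchOut v≢i) (other (punchOut v≢i))

insertEntry : {v i j : Fin (suc n)} → Bool → Matrix n → Dec (v ≡ i) → Dec (v ≡ j) → Bool
insertEntry τ A (yes _)   _         = τ
insertEntry τ A (no _)    (yes _)   = τ
insertEntry τ A (no v≢i) (no v≢j) = adj A (punchOut v≢i) (punchOut v≢j)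

insert : Fin (suc n) → Bool → Matrix n → Matrix (suc n)
insert v τ A = tabulate λ i → tabulate λ j → insertEntry τ A (v ≟ i) (v ≟ j)

module _ (v : Fin (suc n)) (τ : Bool) (A : Matrix n) where

  private
    adj-insert : ∀ i j → adj (insert v τ A) i j ≡ insertEntry τ A (v ≟ i) (v ≟ j)
    adj-insert = adj-tabulate λ i j → insertEntry τ A (v ≟ i) (v ≟ j)

  adj-insert-row : ∀ j → adj (insert v τ A) v j ≡ τ
  adj-insert-row j = trans (adj-insert v j) (entry (v ≟ v))
    where
    entry : (d : Dec (v ≡ v)) → insertEntry τ A d (v ≟ j) ≡ τ
    entry (yes _)  = refl
    entry (no v≢v) = ⊥-elim (v≢v refl)

  adj-insert-col : ∀ i → adj (insert v τ A) i v ≡ τ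
  adj-insert-col i = trans (adj-insert i v) (entry (v ≟ i) (v ≟ v))
    where
    entry : (d : Dec (v ≡ i)) (e : Dec (v ≡ v)) → insertEntry τ A d e ≡ τ
    entry (yes _) _        = refl
    entry (no _)  (yes _)  = refl
    entry (no _)  (no v≢v) = ⊥-elim (v≢v refl)

  adj-insert-punchIn : ∀ i j → adj (insert v τ A) (punchIn v i) (punchIn v j) ≡ adj A i j
  adj-insert-punchIn i j = trans (adj-insert _ _) (entry (v ≟ punchIn v i) (v ≟ punchIn v j))
    where
    entry : (d : Dec (v ≡ punchIn v i)) (e : Dec (v ≡ punchIn v j)) → insertEntry τ A d e ≡ adj A i j
    entry (yes v≡) _       = ⊥-elim (punchInᵢ≢i v i (sym v≡))
    entry (no _)  (yes v≡) = ⊥-elim (punchInᵢ≢i v j (sym v≡))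
    entry (no v≢i) (no v≢j) = cong₂ (adj A)
      (trans (punchOut-cong v refl) (punchOut-punchIn v))
      (trans (punchOut-cong v refl) (punchOut-punchIn v))

  delete-insert : delete v (insert v τ A) ≡ A
  delete-insert = Matrix-ext λ i j → trans (adj-delete v (insert v τ A) i j) (adj-insert-punchIn i j)

  insert-symmetric : Symmetric A → Symmetric (insert v τ A)
  insert-symmetric A-sym i j with split v i | split v j
  ... | pivot   | _       = trans (adj-insert-row j) (sym (adj-insert-col j))
  ... | other i | pivot   = trans (adj-insert-col (punchIn v i)) (sym (adj-insert-row (punchIn v i)))
  ... | other i | other j = trans (adj-insert-punchIn i j) (trans (A-sym i j) (sym (adj-insert-punchIn j i)))

leastWitness : {P : Fin n → Set} → Decidable P → ∀ {w} → P w →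
  Σ (Fin n) λ v → P v × (∀ {u} → P u → v Fin.≤ u)
leastWitness {suc n} P? {w} Pw with P? zero | w
... | yes P0 | _     = zero , P0 , λ _ → z≤n
... | no ¬P0 | zero  = ⊥-elim (¬P0 Pw)
... | no ¬P0 | suc w with leastWitness (P? ∘ suc) Pw
...   | v , Pv , least = suc v , Pv , λ { {zero} P0 → ⊥-elim (¬P0 P0) ; {suc u} Pu → s≤s (least Pu) }

ConstantRow : Matrix n → Fin n → Set
ConstantRow A v = ∀ j → adj A v j ≡ adj A v v

constantRow? : (A : Matrix n) → Decidable (ConstantRow A)
constantRow? A v = all? λ j → adj A v j Bool.≟ adj A v v

insert-delete : ∀ v {A : Matrix (suc n)} → Symmetric A → ConstantRow A v →
  insert v (adj A v v) (delete v A) ≡ A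
insert-delete v {A} A-sym v-const = Matrix-ext entry
  where
  entry : ∀ i j → adj (insert v (adj A v v) (delete v A)) i j ≡ adj A i j
  entry i j with split v i | split v j
  ... | pivot   | _       = trans (adj-insert-row v _ (delete v A) j) (sym (v-const j))
  ... | other i | pivot   = trans (adj-insert-col v _ (delete v A) (punchIn v i))
                                  (trans (sym (v-const (punchIn v i))) (A-sym v (punchIn v i)))
  ... | other i | other j = trans (adj-insert-punchIn v _ (delete v A) i j) (adj-delete v A i j)

-- Ranking the vertices by the order in which they were added, two vertices are adjacent
-- exactly when the later one is looped.
ThresholdRanking : Matrix n → Set
ThresholdRanking {n} A = Σ (Fin n → ℕ) λ rank → ∀ i j → rank i ≤ rank j → adj A i j ≡ adj A j j

ranking-delete : ∀ v {A : Matrix (suc n)} → ThresholdRanking A → ThresholdRanking (delete v A)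
ranking-delete v {A} (rank , ranked) = rank ∘ punchIn v , λ i j i≤j →
  trans (adj-delete v A i j) (trans (ranked _ _ i≤j) (sym (adj-delete v A j j)))

ranking-extend : ∀ v {A : Matrix (suc n)} {c} → Symmetric A → (∀ j → adj A v j ≡ c) →
  ThresholdRanking (delete v A) → ThresholdRanking A
ranking-extend {n} v {A} A-sym v-row (rank , ranked) = rank′ ∘ split v , ranked′
  where
  top : ℕ
  top = max 0 (map rank (allFin n))
  rank′ : ∀ {i} → Split v i → ℕ
  rank′ pivot     = suc top
  rank′ (other i) = rank i
  ranked′ : ∀ i j → rank′ (split v i) ≤ rank′ (split v j) → adj A i j ≡ adj A j j
  ranked′ i j i≤j with split v i | split v j
  ... | _       | pivot   = trans (A-sym i v) (trans (v-row i) (sym (v-row v)))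
  ... | pivot   | other j = ⊥-elim (ℕ.<⇒≱ (s≤s (All.lookup (xs≤max 0 _) (∈-map⁺ rank (∈-allFin j)))) i≤j)
  ... | other i | other j = begin
    adj A (punchIn v i) (punchIn v j) ≡⟨ adj-delete v A i j ⟨
    adj (delete v A) i j              ≡⟨ ranked i j i≤j ⟩
    adj (delete v A) j j              ≡⟨ adj-delete v A j j ⟩
    adj A (punchIn v j) (punchIn v j) ∎
    where open ≡-Reasoning

loopThreshold⇒ranking : {A : Matrix n} → Symmetric A → LoopThreshold A → ThresholdRanking A
loopThreshold⇒ranking A-sym (base b) = (λ _ → 0) , λ { zero zero _ → refl }
loopThreshold⇒ranking A-sym (addIsolated A v v-row A-v) =
  ranking-extend v {A} A-sym v-row (loopThreshold⇒ranking (delete-symmetric v {A} A-sym) A-v)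
loopThreshold⇒ranking A-sym (addDominating A v v-row A-v) =
  ranking-extend v {A} A-sym v-row (loopThreshold⇒ranking (delete-symmetric v {A} A-sym) A-v)

ranking⇒constantRow : {A : Matrix (suc n)} → Symmetric A → ThresholdRanking A → ∃ (ConstantRow A)
ranking⇒constantRow {n} {A} A-sym (rank , ranked) = top , λ j →
  trans (A-sym top j) (ranked j top (All.lookup (f[xs]≤f[argmax] {f = rank} zero (allFin (suc n))) (∈-allFin j)))
  where
  top : Fin (suc n)
  top = argmax rank zero (allFin (suc n))

-- Insertion codes and their graphs

InsertionCode : ℕ → Set
InsertionCode zero    = ⊤
InsertionCode (suc m) = Fin (suc (suc m)) × InsertionCode m

toPermutation : InsertionCode m → Vec (Fin (suc m)) (suc m)
toPermutation {zero}  _       = zero ∷ []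
toPermutation {suc m} (v , p) = v ∷ Vec.map (punchIn v) (toPermutation p)

leader : InsertionCode m → Fin (suc m)
leader p = head (toPermutation p)

Compatible : InsertionCode m → Vec Bool (suc m) → Set
Compatible {zero}  _       _        = ⊤
Compatible {suc m} (v , p) (τ ∷ ts) = (τ ≡ head ts → v Fin.< punchIn v (leader p)) × Compatible p ts

graph : InsertionCode m → Vec Bool (suc m) → Matrix (suc m)
graph {zero}  _       (b ∷ [])  = (b ∷ []) ∷ []
graph {suc m} (v , p) (τ ∷ ts) = insert v τ (graph p ts)

graph-symmetric : (p : InsertionCode m) (ts : Vec Bool (suc m)) → Symmetric (graph p ts)
graph-symmetric {zero}  _       (b ∷ []) zero zero = refl
graph-symmetric {suc m} (v , p) (τ ∷ ts)         = insert-symmetric v τ _ (graph-symmetric p ts)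

graph-loopThreshold : (p : InsertionCode m) (ts : Vec Bool (suc m)) → LoopThreshold (graph p ts)
graph-loopThreshold {zero}  _       (b ∷ [])     = base b
graph-loopThreshold {suc m} (v , p) (false ∷ ts) =
  addIsolated _ v (adj-insert-row v false _)
    (subst LoopThreshold (sym (delete-insert v false _)) (graph-loopThreshold p ts))
graph-loopThreshold {suc m} (v , p) (true ∷ ts) =
  addDominating _ v (adj-insert-row v true _)
    (subst LoopThreshold (sym (delete-insert v true _)) (graph-loopThreshold p ts))

adj-graph-leader : (p : InsertionCode m) (ts : Vec Bool (suc m)) → ∀ j → adj (graph p ts) (leader p) j ≡ head ts
adj-graph-leader {zero}  _       (b ∷ []) zero = refl
adj-graph-leader {suc m} (v , p) (τ ∷ ts)      = adj-insert-row v τ _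

constantRow-insert⁻ : ∀ v τ (A : Matrix n) u → ConstantRow (insert v τ A) (punchIn v u) → ConstantRow A u
constantRow-insert⁻ v τ A u u-const j = begin
  adj A u j                                       ≡⟨ adj-insert-punchIn v τ A u j ⟨
  adj (insert v τ A) (punchIn v u) (punchIn v j)  ≡⟨ u-const (punchIn v j) ⟩
  adj (insert v τ A) (punchIn v u) (punchIn v u)  ≡⟨ adj-insert-punchIn v τ A u u ⟩
  adj A u u                                       ∎
  where open ≡-Reasoning

leader-least : (p : InsertionCode m) (ts : Vec Bool (suc m)) → Compatible p ts →
  ∀ {u} → ConstantRow (graph p ts) u → leader p Fin.≤ u
leader-least {zero}  _       _        _                    _       = z≤n
leader-least {suc m} (v , p) (τ ∷ ts) (ascent , compatible) {u} u-const with split v u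
... | pivot   = ℕ.≤-refl
... | other u = ℕ.<⇒≤ (ℕ.<-≤-trans (ascent τ≡head)
                  (punchIn-mono-≤ v (leader p) u (leader-least p ts compatible u-const′)))
  where
  G : Matrix (suc m)
  G = graph p ts
  u-const′ : ConstantRow G u
  u-const′ = constantRow-insert⁻ v τ G u u-const
  τ≡head : τ ≡ head ts
  τ≡head = begin
    τ                                            ≡⟨ adj-insert-col v τ G (punchIn v u) ⟨
    adj (insert v τ G) (punchIn v u) v            ≡⟨ u-const v ⟩
    adj (insert v τ G) (punchIn v u) (punchIn v u) ≡⟨ adj-insert-punchIn v τ G u u ⟩
    adj G u u                                    ≡⟨ u-const′ (leader p) ⟨
    adj G u (leader p)                           ≡⟨ graph-symmetric p ts u (leader p) ⟩
    adj G (leader p) u                           ≡⟨ adj-graph-leader p ts u ⟩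
    head ts                                      ∎
    where open ≡-Reasoning

leader-constantRow : (p : InsertionCode m) (ts : Vec Bool (suc m)) → ConstantRow (graph p ts) (leader p)
leader-constantRow p ts j = trans (adj-graph-leader p ts j) (sym (adj-graph-leader p ts (leader p)))

leader-unique : (p q : InsertionCode m) (ts us : Vec Bool (suc m)) → Compatible p ts → Compatible q us →
  graph p ts ≡ graph q us → leader p ≡ leader q
leader-unique p q ts us p-compat q-compat G≡H = toℕ-injective (ℕ.≤-antisym
  (leader-least p ts p-compat (subst (λ A → ConstantRow A (leader q)) (sym G≡H) (leader-constantRow q us)))
  (leader-least q us q-compat (subst (λ A → ConstantRow A (leader p)) G≡H (leader-constantRow p ts))))

graph-injective : (p q : InsertionCode m) (ts us : Vec Bool (suc m)) → Compatible p ts → Compatible q us →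
  graph p ts ≡ graph q us → p ≡ q × ts ≡ us
graph-injective {zero}  _       _       (b ∷ []) (c ∷ []) _ _ G≡H = refl , cong head G≡H
graph-injective {suc m} (v , p) (w , q) (τ ∷ ts) (σ ∷ us) p-compat q-compat G≡H
  with leader-unique (v , p) (w , q) (τ ∷ ts) (σ ∷ us) p-compat q-compat G≡H
... | refl with graph-injective p q ts us (proj₂ p-compat) (proj₂ q-compat) (begin
      graph p ts                          ≡⟨ delete-insert v τ _ ⟨
      delete v (graph (v , p) (τ ∷ ts))   ≡⟨ cong (delete v) G≡H ⟩
      delete v (graph (v , q) (σ ∷ us))   ≡⟨ delete-insert v σ _ ⟩
      graph q us                          ∎)
  where open ≡-Reasoning
... | refl , refl = refl , cong (_∷ ts) (begin
      τ                                   ≡⟨ adj-insert-row v τ _ v ⟨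
      adj (graph (v , p) (τ ∷ ts)) v v    ≡⟨ cong (λ A → adj A v v) G≡H ⟩
      adj (graph (v , p) (σ ∷ ts)) v v    ≡⟨ adj-insert-row v σ _ v ⟩
      σ                                   ∎)
  where open ≡-Reasoning

Encoding : Matrix (suc m) → Set
Encoding {m} A = Σ (InsertionCode m) λ p → Σ (Vec Bool (suc m)) λ ts → Compatible p ts × graph p ts ≡ A

encoding-extend : ∀ {A : Matrix (suc (suc m))} v → Symmetric A → ConstantRow A v →
  (∀ {u} → ConstantRow A u → v Fin.≤ u) → Encoding (delete v A) → Encoding A
encoding-extend {m} {A} v A-sym v-const v-least (p , ts , p-compat , G≡A∖v) =
  (v , p) , (adj A v v ∷ ts) , (ascent , p-compat) ,
  trans (cong (insert v (adj A v v)) G≡A∖v) (insert-delete v A-sym v-const)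
  where
  u : Fin (suc (suc m))
  u = punchIn v (leader p)
  u-row : adj A v v ≡ head ts → ∀ j → adj A u j ≡ head ts
  u-row loop≡head j with split v j
  ... | pivot   = trans (A-sym u v) (trans (v-const u) loop≡head)
  ... | other j = begin
    adj A u (punchIn v j)             ≡⟨ adj-delete v A (leader p) j ⟨
    adj (delete v A) (leader p) j     ≡⟨ cong (λ B → adj B (leader p) j) G≡A∖v ⟨
    adj (graph p ts) (leader p) j     ≡⟨ adj-graph-leader p ts j ⟩
    head ts                           ∎
    where open ≡-Reasoning
  ascent : adj A v v ≡ head ts → v Fin.< u
  ascent loop≡head = ℕ.≤∧≢⇒< {toℕ v} {toℕ u}
    (v-least {u} λ j → trans (u-row loop≡head j) (sym (u-row loop≡head u)))
    (λ v≡u → punchInᵢ≢i v (leader p) (sym (toℕ-injective v≡u)))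

graph-surjective : ∀ m {A : Matrix (suc m)} → Symmetric A → ThresholdRanking A → Encoding A
graph-surjective zero    {(b ∷ []) ∷ []} _ _ = tt , (b ∷ []) , tt , refl
graph-surjective (suc m) {A} A-sym A-ranked =
  let _ , w-const         = ranking⇒constantRow {A = A} A-sym A-ranked
      v , v-const , v-least = leastWitness (constantRow? A) w-const
  in  encoding-extend v A-sym v-const v-least
        (graph-surjective m (delete-symmetric v {A} A-sym) (ranking-delete v {A} A-ranked))

-- Ascents and compatible type sequences

isAscent : Fin n → Fin n → Bool
isAscent i j = toℕ i <ᵇ toℕ j

isAscent⇔< : ∀ {i j : Fin n} → T (isAscent i j) ⇔ i Fin.< j
isAscent⇔< = mk⇔ (ℕ.<ᵇ⇒< _ _) ℕ.<⇒<ᵇ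

isAscent-punchIn : ∀ (v : Fin (suc n)) i j → isAscent (punchIn v i) (punchIn v j) ≡ isAscent i j
isAscent-punchIn v i j = det
  (fromEquivalence (cancel ∘ ℕ.<ᵇ⇒< _ _) (ℕ.<⇒<ᵇ ∘ mono))
  (ℕ.<ᵇ-reflects-< (toℕ i) (toℕ j))
  where
  mono : i Fin.< j → punchIn v i Fin.< punchIn v j
  mono i<j = ℕ.≰⇒> λ j′≤i′ → ℕ.<⇒≱ i<j (punchIn-cancel-≤ v j i j′≤i′)
  cancel : punchIn v i Fin.< punchIn v j → i Fin.< j
  cancel i′<j′ = ℕ.≰⇒> λ j≤i → ℕ.<⇒≱ i′<j′ (punchIn-mono-≤ v j i j≤i)

ascents-map : (f : Fin n → Fin k) → (∀ i j → isAscent (f i) (f j) ≡ isAscent i j) →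
  ∀ xs → ascents (map f xs) ≡ ascents xs
ascents-map f f-asc []           = refl
ascents-map f f-asc (x ∷ [])     = refl
ascents-map f f-asc (x ∷ y ∷ xs) =
  cong₂ (λ b a → (if b then 1 else 0) + a) (f-asc x y) (ascents-map f f-asc (y ∷ xs))

startsWithAscent : InsertionCode (suc m) → Bool
startsWithAscent (v , p) = isAscent v (punchIn v (leader p))

ascents-toPermutation : (p : InsertionCode (suc m)) →
  ascents (toList (toPermutation p))
    ≡ (if startsWithAscent p then 1 else 0) + ascents (toList (toPermutation (proj₂ p)))
ascents-toPermutation (v , p) with toPermutation p
... | x ∷ xs = cong (_ +_) (trans (cong (λ l → ascents (punchIn v x ∷ l)) (toList-map (punchIn v) xs))
                                  (ascents-map (punchIn v) (isAscent-punchIn v) (x ∷ toList xs)))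

insertionCodes : ∀ m → List (InsertionCode m)
insertionCodes zero    = tt ∷ []
insertionCodes (suc m) = concatMap (λ v → map (v ,_) (insertionCodes m)) (allFin (suc (suc m)))

insertionCodes-unique : ∀ m → Unique (insertionCodes m)
insertionCodes-unique zero    = [] ∷ []
insertionCodes-unique (suc m) = Unique-concatMap-map _,_ (λ _ → insertionCodes m) proj₁ (λ _ _ → refl)
  (cong proj₂) (allFin⁺ _) (λ _ → insertionCodes-unique m)

∈-insertionCodes : (p : InsertionCode m) → p ∈ insertionCodes m
∈-insertionCodes {zero}  tt      = here refl
∈-insertionCodes {suc m} (v , p) =
  ∈-concatMap-map⁺ _,_ (λ _ → insertionCodes m) (∈-allFin v) (∈-insertionCodes p)

typeChoices : (ascent : Bool) → Bool → List Bool
typeChoices true  σ = true ∷ false ∷ []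
typeChoices false σ = not σ ∷ []

∈-typeChoices : ∀ b σ {τ} → τ ∈ typeChoices b σ ⇔ (τ ≡ σ → T b)
∈-typeChoices true  σ {τ} = mk⇔ (λ _ _ → tt) (λ _ → every τ)
  where
  every : ∀ τ → τ ∈ true ∷ false ∷ []
  every true  = here refl
  every false = there (here refl)
∈-typeChoices false σ     = mk⇔ (λ { (here refl) σ′≡σ → Bool.not-¬ refl (sym σ′≡σ) })
                                (λ τ≢σ → here (Bool.¬-not τ≢σ))

length-typeChoices : ∀ b σ → length (typeChoices b σ) ≡ (if b then 2 else 1)
length-typeChoices true  σ = refl
length-typeChoices false σ = refl

compatibleTypes : InsertionCode m → List (Vec Bool (suc m))
compatibleTypes {zero}  _       = (true ∷ []) ∷ (false ∷ []) ∷ []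
compatibleTypes {suc m} (v , p) =
  concatMap (λ ts → map (_∷ ts) (typeChoices (startsWithAscent (v , p)) (head ts))) (compatibleTypes p)

compatibleTypes-unique : (p : InsertionCode m) → Unique (compatibleTypes p)
compatibleTypes-unique {zero}  _       = ((λ ()) ∷ []) ∷ [] ∷ []
compatibleTypes-unique {suc m} (v , p) =
  Unique-concatMap-map (λ ts τ → τ ∷ ts) (typeChoices b ∘ head) Vec.tail (λ _ _ → refl) (cong head)
    (compatibleTypes-unique p) (choices-unique b ∘ head)
  where
  b : Bool
  b = startsWithAscent (v , p)
  choices-unique : ∀ b σ → Unique (typeChoices b σ)
  choices-unique true  σ = ((λ ()) ∷ []) ∷ [] ∷ []
  choices-unique false σ = [] ∷ []

∈-compatibleTypes : (p : InsertionCode m) {ts : Vec Bool (suc m)} → ts ∈ compatibleTypes p ⇔ Compatible p ts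
∈-compatibleTypes {zero} _ = mk⇔ (λ _ → tt) (λ _ → every _)
  where
  every : ∀ ts → ts ∈ compatibleTypes {zero} tt
  every (true ∷ [])  = here refl
  every (false ∷ []) = there (here refl)
∈-compatibleTypes {suc m} (v , p) = mk⇔ sound complete
  where
  choices : Vec Bool (suc m) → List Bool
  choices ts = typeChoices (startsWithAscent (v , p)) (head ts)
  sound : ∀ {ts} → ts ∈ compatibleTypes (v , p) → Compatible (v , p) ts
  sound ts∈ with ∈-concatMap-map⁻ (λ ts τ → τ ∷ ts) choices {compatibleTypes p} ts∈
  ... | ts , τ , ts∈′ , τ∈ , refl =
    Equivalence.to isAscent⇔< ∘ Equivalence.to (∈-typeChoices _ (head ts)) τ∈ ,
    Equivalence.to (∈-compatibleTypes p) ts∈′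
  complete : ∀ {ts} → Compatible (v , p) ts → ts ∈ compatibleTypes (v , p)
  complete {τ ∷ ts} (ascent , compatible) = ∈-concatMap-map⁺ (λ ts τ → τ ∷ ts) choices
    (Equivalence.from (∈-compatibleTypes p) compatible)
    (Equivalence.from (∈-typeChoices _ (head ts)) (Equivalence.from isAscent⇔< ∘ ascent))

length-compatibleTypes : (p : InsertionCode m) →
  length (compatibleTypes p) ≡ 2 ^ suc (ascents (toList (toPermutation p)))
length-compatibleTypes {zero}  _       = refl
length-compatibleTypes {suc m} (v , p) = begin
  length (compatibleTypes (v , p))
    ≡⟨ length-concatMap-map (λ ts τ → τ ∷ ts) (typeChoices b ∘ head) (compatibleTypes p) ⟩
  sum (map (λ ts → length (typeChoices b (head ts))) (compatibleTypes p))
    ≡⟨ sum-map-const _ (length-typeChoices b ∘ head) (compatibleTypes p) ⟩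
  (if b then 2 else 1) * length (compatibleTypes p)
    ≡⟨ cong ((if b then 2 else 1) *_) (length-compatibleTypes p) ⟩
  (if b then 2 else 1) * 2 ^ suc a
    ≡⟨ doubling b ⟩
  2 ^ suc ((if b then 1 else 0) + a)
    ≡⟨ cong (λ k → 2 ^ suc k) (ascents-toPermutation (v , p)) ⟨
  2 ^ suc (ascents (toList (toPermutation (v , p)))) ∎
  where
  open ≡-Reasoning
  b : Bool
  b = startsWithAscent (v , p)
  a : ℕ
  a = ascents (toList (toPermutation p))
  doubling : ∀ b → (if b then 2 else 1) * 2 ^ suc a ≡ 2 ^ suc ((if b then 1 else 0) + a)
  doubling true  = refl
  doubling false = ℕ.*-identityˡ _

-- Permutations

allVecs-unique : ∀ n m → Unique (allVecs n m)
allVecs-unique n zero    = [] ∷ []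
allVecs-unique n (suc m) = Unique-concatMap-map _∷_ (λ _ → allVecs n m) head (λ _ _ → refl)
  ∷-injectiveʳ (allFin⁺ n) (λ _ → allVecs-unique n m)

∈-allVecs : (xs : Vec (Fin n) m) → xs ∈ allVecs n m
∈-allVecs []       = here refl
∈-allVecs (x ∷ xs) = ∈-concatMap-map⁺ _∷_ (λ _ → allVecs _ _) (∈-allFin x) (∈-allVecs xs)

notIn⇒All≢ : ∀ (x : Fin n) xs → notIn x xs ≡ true → All (x ≢_) xs
notIn⇒All≢ x []       _  = []
notIn⇒All≢ x (y ∷ xs) eq with x Fin.≟ y
... | no x≢y = x≢y ∷ notIn⇒All≢ x xs eq

All≢⇒notIn : ∀ (x : Fin n) xs → All (x ≢_) xs → notIn x xs ≡ true
All≢⇒notIn x []       []           = refl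
All≢⇒notIn x (y ∷ xs) (x≢y ∷ x∉xs) with x Fin.≟ y
... | yes x≡y = ⊥-elim (x≢y x≡y)
... | no _    = All≢⇒notIn x xs x∉xs

distinct⇔Unique : (xs : List (Fin n)) → distinct xs ≡ true ⇔ Unique xs
distinct⇔Unique xs = mk⇔ (to xs) (from xs)
  where
  to : ∀ xs → distinct xs ≡ true → Unique xs
  to []       _  = []
  to (x ∷ xs) eq with notIn x xs in x∉xs
  ... | true = notIn⇒All≢ x xs x∉xs ∷ to xs eq
  from : ∀ xs → Unique xs → distinct xs ≡ true
  from []       []           = refl
  from (x ∷ xs) (x∉xs ∷ xs!) rewrite All≢⇒notIn x xs x∉xs = from xs xs!

∈-permutations : (π : Vec (Fin n) n) → π ∈ permutations n ⇔ Unique (toList π)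
∈-permutations π = mk⇔
  (λ π∈ → Equivalence.to (distinct⇔Unique (toList π)) (proj₂ (∈-filter⁻ distinct? {xs = allVecs _ _} π∈)))
  (λ π! → ∈-filter⁺ distinct? (∈-allVecs π) (Equivalence.from (distinct⇔Unique (toList π)) π!))
  where
  distinct? : (π : Vec (Fin n) n) → Dec (distinct (toList π) ≡ true)
  distinct? π = distinct (toList π) Bool.≟ true

permutations-unique : ∀ n → Unique (permutations n)
permutations-unique n = filter⁺ (λ π → distinct (toList π) Bool.≟ true) (allVecs-unique n n)

toPermutation-injective : (p q : InsertionCode m) → toPermutation p ≡ toPermutation q → p ≡ q
toPermutation-injective {zero}  _       _       _   = refl
toPermutation-injective {suc m} (v , p) (w , q) p≡q with ∷-injective p≡q
... | refl , p≡q′ = cong (v ,_) (toPermutation-injective p q (map-punchIn-injective p≡q′))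
  where
  map-punchIn-injective : ∀ {k} {xs ys : Vec (Fin (suc m)) k} →
    Vec.map (punchIn v) xs ≡ Vec.map (punchIn v) ys → xs ≡ ys
  map-punchIn-injective {xs = []}     {[]}     _  = refl
  map-punchIn-injective {xs = x ∷ xs} {y ∷ ys} eq with ∷-injective eq
  ... | x≡y , xs≡ys = cong₂ _∷_ (punchIn-injective v x y x≡y) (map-punchIn-injective xs≡ys)

toPermutation-unique : (p : InsertionCode m) → Unique (toList (toPermutation p))
toPermutation-unique {zero}  _       = [] ∷ []
toPermutation-unique {suc m} (v , p) rewrite toList-map (punchIn v) (toPermutation p) =
  All.map⁺ (All.universal (λ i v≡ → punchInᵢ≢i v i (sym v≡)) _)
  ∷ map⁺ (punchIn-injective v _ _) (toPermutation-unique p)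

toPermutation-surjective : (π : Vec (Fin (suc m)) (suc m)) → Unique (toList π) →
  Σ (InsertionCode m) λ p → toPermutation p ≡ π
toPermutation-surjective {zero}  (zero ∷ []) _            = tt , refl
toPermutation-surjective {suc m} (v ∷ xs)    (v∉xs ∷ xs!) =
  let ys , ys↦xs = punchOut-all xs v∉xs
      p , p↦ys   = toPermutation-surjective ys
                     (map⁻ (subst Unique (toList-map (punchIn v) ys) (subst (Unique ∘ toList) (sym ys↦xs) xs!)))
  in  (v , p) , cong (v ∷_) (trans (cong (Vec.map (punchIn v)) p↦ys) ys↦xs)
  where
  punchOut-all : ∀ {k} (xs : Vec (Fin (suc (suc m))) k) → All (v ≢_) (toList xs) →
    Σ (Vec (Fin (suc m)) k) λ ys → Vec.map (punchIn v) ys ≡ xs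
  punchOut-all []       []          = [] , refl
  punchOut-all (x ∷ xs) (v≢x ∷ v∉xs) =
    let ys , ys↦xs = punchOut-all xs v∉xs
    in  Fin.punchOut v≢x ∷ ys , cong₂ _∷_ (punchIn-punchOut v≢x) ys↦xs

insertionCodes↭permutations : ∀ m → map toPermutation (insertionCodes m) ↭ permutations (suc m)
insertionCodes↭permutations m =
  ↭-from-members (map⁺ (toPermutation-injective _ _) (insertionCodes-unique m)) (permutations-unique (suc m))
    (mk⇔ to from)
  where
  to : ∀ {π} → π ∈ map toPermutation (insertionCodes m) → π ∈ permutations (suc m)
  to π∈ with ∈-map⁻ toPermutation π∈
  ... | p , _ , refl = Equivalence.from (∈-permutations _) (toPermutation-unique p)
  from : ∀ {π} → π ∈ permutations (suc m) → π ∈ map toPermutation (insertionCodes m)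
  from {π} π∈ with toPermutation-surjective π (Equivalence.to (∈-permutations π) π∈)
  ... | p , refl = ∈-map⁺ toPermutation (∈-insertionCodes p)

ascents-cons-≤ : ∀ (x : Fin n) xs → ascents (x ∷ xs) ≤ length xs
ascents-cons-≤ x []       = z≤n
ascents-cons-≤ x (y ∷ xs) = ℕ.+-mono-≤ (bit≤1 (isAscent x y)) (ascents-cons-≤ y xs)
  where
  bit≤1 : ∀ b → (if b then 1 else 0) ≤ 1
  bit≤1 true  = s≤s z≤n
  bit≤1 false = z≤n

ascents-< : (π : Vec (Fin n) (suc m)) → ascents (toList π) < suc m
ascents-< (x ∷ xs) = s≤s (subst (ascents (x ∷ toList xs) ≤_) (length-toList xs) (ascents-cons-≤ x (toList xs)))

compatibleCodes : ∀ m → List (InsertionCode m × Vec Bool (suc m))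
compatibleCodes m = concatMap (λ p → map (p ,_) (compatibleTypes p)) (insertionCodes m)

compatibleCodes-unique : ∀ m → Unique (compatibleCodes m)
compatibleCodes-unique m = Unique-concatMap-map _,_ compatibleTypes proj₁ (λ _ _ → refl) (cong proj₂)
  (insertionCodes-unique m) compatibleTypes-unique

∈-compatibleCodes : ∀ {m} p ts → (p , ts) ∈ compatibleCodes m ⇔ Compatible p ts
∈-compatibleCodes {m} p ts = mk⇔ sound complete
  where
  sound : (p , ts) ∈ compatibleCodes m → Compatible p ts
  sound pts∈ with ∈-concatMap-map⁻ _,_ compatibleTypes {insertionCodes m} pts∈
  ... | p , ts , _ , ts∈ , refl = Equivalence.to (∈-compatibleTypes p) ts∈
  complete : Compatible p ts → (p , ts) ∈ compatibleCodes m
  complete compatible = ∈-concatMap-map⁺ _,_ compatibleTypes (∈-insertionCodes p)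
    (Equivalence.from (∈-compatibleTypes p) compatible)

eulerianSum≡length-compatibleCodes : ∀ m →
  sumTo (suc m) (λ k → Eulerian (suc m) k * 2 ^ suc k) ≡ length (compatibleCodes m)
eulerianSum≡length-compatibleCodes m = begin
  sumTo (suc m) (λ k → Eulerian (suc m) k * 2 ^ suc k)
    ≡⟨ sumTo-count (suc m) (ascents ∘ toList) (λ k → 2 ^ suc k) {permutations (suc m)}
         (All.tabulate λ {π} _ → ascents-< π) ⟩
  sum (map (λ π → 2 ^ suc (ascents (toList π))) (permutations (suc m)))
    ≡⟨ sum-map-↭ _ (insertionCodes↭permutations m) ⟨
  sum (map (λ π → 2 ^ suc (ascents (toList π))) (map toPermutation (insertionCodes m)))
    ≡⟨ cong sum (map-∘ (insertionCodes m)) ⟨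
  sum (map (λ p → 2 ^ suc (ascents (toList (toPermutation p)))) (insertionCodes m))
    ≡⟨ cong sum (map-cong length-compatibleTypes (insertionCodes m)) ⟨
  sum (map (length ∘ compatibleTypes) (insertionCodes m))
    ≡⟨ length-concatMap-map _,_ compatibleTypes (insertionCodes m) ⟨
  length (compatibleCodes m) ∎
  where open ≡-Reasoning

loopThreshold-count : ∀ m → HasCount (LabelledLoopThreshold (suc m)) (length (compatibleCodes m))
loopThreshold-count m =
  HasCount-map (uncurry graph) (compatibleCodes-unique m) injective (λ A → mk⇔ (encode A) decode)
  where
  InImage : Matrix (suc m) → Set
  InImage A = Σ (InsertionCode m × Vec Bool (suc m)) λ c → c ∈ compatibleCodes m × uncurry graph c ≡ A
  injective : ∀ {c d} → c ∈ compatibleCodes m → d ∈ compatibleCodes m →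
    uncurry graph c ≡ uncurry graph d → c ≡ d
  injective {p , ts} {q , us} c∈ d∈ G≡H with graph-injective p q ts us
    (Equivalence.to (∈-compatibleCodes p ts) c∈) (Equivalence.to (∈-compatibleCodes q us) d∈) G≡H
  ... | refl , refl = refl
  encode : ∀ A → LabelledLoopThreshold (suc m) A → InImage A
  encode A (A-sym , A-lt) =
    let p , ts , compatible , G≡A = graph-surjective m A-sym (loopThreshold⇒ranking A-sym A-lt)
    in  (p , ts) , Equivalence.from (∈-compatibleCodes p ts) compatible , G≡A
  decode : ∀ {A} → InImage A → LabelledLoopThreshold (suc m) A
  decode ((p , ts) , _ , refl) = graph-symmetric p ts , graph-loopThreshold p ts

mainTheorem6 : (n : ℕ) → 1 ≤ n →
    HasCount (LabelledLoopThreshold n)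
      (sumTo n (λ k → Eulerian n k * 2 ^ suc k))
mainTheorem6 zero    ()
mainTheorem6 (suc m) _  =
  subst (HasCount (LabelledLoopThreshold (suc m)))
    (sym (eulerianSum≡length-compatibleCodes m))
    (loopThreshold-count m)
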